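{- In a category $\mathcal{C}$ with cofibrations and an interval satisfying the general conditions (G1)–(G7) below, every trivial cofibration is a cofibration.
   Context: $\mathcal{C}$ is locally cartesian closed with finite colimits, with a class of maps called cofibrations and an interval $\delta_0,\delta_1\colon1\to\mathbb{I}$. Trivial fibrations: maps with the right lifting property (RLP) against all cofibrations. Fibrations: maps with the RLP against $\delta_0\hat\times m$ and $\delta_1\hat\times m$ for all cofibrations $m$, where $f\hat\times g$ is the pushout product $(A\times D)\sqcup_{A\times C}(B\times C)\to B\times D$ of $f\colon A\to B$, $g\colon C\to D$. Trivial cofibrations: maps with the left lifting property against all fibrations. (G1) cofibrations are closed under pullback; (G2) cofibrations are closed under binary unions; (G3) $\mathbb{I}$ has connections $\wedge,\vee$ with $0\wedge i=i\wedge0=0$, $1\wedge i=i\wedge 1=i$, $0\vee i=i\vee 0=i$, $1\vee i=i\vee1=1$; (G4) $\delta_0,\delta_1$ are disjoint subobjects; (G5) $\delta_0,\delta_1$ are cofibrations; (G6) every map factors as a cofibration followed by a trivial fibration; (G7) every map $0\to X$ is a cofibration. -}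

module Defs where

open import Level using (Level; _⊔_; suc)
open import Data.Product using (Σ; _×_; _,_)
open import Relation.Binary using (Rel; IsEquivalence)

record Category (o ℓ e : Level) : Set (suc (o ⊔ ℓ ⊔ e)) where
  infixr 9 _∘_
  infix  4 _≈_
  infix  5 _⇒_
  field
    Obj   : Set o
    _⇒_   : Obj → Obj → Set ℓ
    _≈_   : ∀ {A B} → Rel (A ⇒ B) e
    id    : ∀ {A} → A ⇒ A
    _∘_   : ∀ {A B C} → B ⇒ C → A ⇒ B → A ⇒ C
    ≈-equiv   : ∀ {A B} → IsEquivalence (_≈_ {A} {B})
    ∘-resp-≈  : ∀ {A B C} {f h : B ⇒ C} {g i : A ⇒ B} →
                f ≈ h → g ≈ i → f ∘ g ≈ h ∘ i
    identityˡ : ∀ {A B} {f : A ⇒ B} → id ∘ f ≈ f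
    identityʳ : ∀ {A B} {f : A ⇒ B} → f ∘ id ≈ f
    assoc     : ∀ {A B C D} {f : A ⇒ B} {g : B ⇒ C} {h : C ⇒ D} →
                (h ∘ g) ∘ f ≈ h ∘ (g ∘ f)

module WithCat {o ℓ e : Level} (𝒞 : Category o ℓ e) where
  open Category 𝒞

  Mono : ∀ {A B} → A ⇒ B → Set (o ⊔ ℓ ⊔ e)
  Mono {A} m = ∀ {Z} (f g : Z ⇒ A) → m ∘ f ≈ m ∘ g → f ≈ g

  IsTerminal : Obj → Set (o ⊔ ℓ ⊔ e)
  IsTerminal T = ∀ X → Σ (X ⇒ T) λ t → ∀ (s : X ⇒ T) → s ≈ t

  IsInitial : Obj → Set (o ⊔ ℓ ⊔ e)
  IsInitial I = ∀ X → Σ (I ⇒ X) λ t → ∀ (s : I ⇒ X) → s ≈ t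

  IsPullback : ∀ {P A B X} → A ⇒ X → B ⇒ X → P ⇒ A → P ⇒ B → Set (o ⊔ ℓ ⊔ e)
  IsPullback {P} {A} {B} f g p q =
    (f ∘ p ≈ g ∘ q) ×
    (∀ {Z} (a : Z ⇒ A) (b : Z ⇒ B) → f ∘ a ≈ g ∘ b →
       Σ (Z ⇒ P) λ u → (p ∘ u ≈ a) × (q ∘ u ≈ b) ×
         (∀ (v : Z ⇒ P) → p ∘ v ≈ a → q ∘ v ≈ b → v ≈ u))

  IsPushout : ∀ {X A B Q} → X ⇒ A → X ⇒ B → A ⇒ Q → B ⇒ Q → Set (o ⊔ ℓ ⊔ e)
  IsPushout {X} {A} {B} {Q} f g i j =
    (i ∘ f ≈ j ∘ g) ×
    (∀ {Z} (a : A ⇒ Z) (b : B ⇒ Z) → a ∘ f ≈ b ∘ g →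
       Σ (Q ⇒ Z) λ u → (u ∘ i ≈ a) × (u ∘ j ≈ b) ×
         (∀ (v : Q ⇒ Z) → v ∘ i ≈ a → v ∘ j ≈ b → v ≈ u))

  record Product (A B : Obj) : Set (o ⊔ ℓ ⊔ e) where
    field
      A×B   : Obj
      π₁    : A×B ⇒ A
      π₂    : A×B ⇒ B
      ⟨_,_⟩ : ∀ {Z} → Z ⇒ A → Z ⇒ B → Z ⇒ A×B
      project₁ : ∀ {Z} {f : Z ⇒ A} {g : Z ⇒ B} → π₁ ∘ ⟨ f , g ⟩ ≈ f
      project₂ : ∀ {Z} {f : Z ⇒ A} {g : Z ⇒ B} → π₂ ∘ ⟨ f , g ⟩ ≈ g
      unique   : ∀ {Z} {f : Z ⇒ A} {g : Z ⇒ B} (h : Z ⇒ A×B) →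
                 π₁ ∘ h ≈ f → π₂ ∘ h ≈ g → h ≈ ⟨ f , g ⟩

  -- Dependent product Π_f p along f : A → B of p : X → A
  -- (a right adjoint value of pullback f* : 𝒞/B → 𝒞/A at p).
  record DependentProduct {A B X : Obj} (f : A ⇒ B) (p : X ⇒ A) : Set (o ⊔ ℓ ⊔ e) where
    field
      Πobj  : Obj
      Πmap  : Πobj ⇒ B
      E     : Obj
      e₁    : E ⇒ Πobj
      e₂    : E ⇒ A
      E-pb  : IsPullback Πmap f e₁ e₂
      ev    : E ⇒ X
      ev-over : p ∘ ev ≈ e₂
      universal :
        ∀ {Y F} (r : Y ⇒ B) (g₁ : F ⇒ Y) (g₂ : F ⇒ A) → IsPullback r f g₁ g₂ →
        (g : F ⇒ X) → p ∘ g ≈ g₂ →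
        Σ (Y ⇒ Πobj) λ h →
          (Πmap ∘ h ≈ r) ×
          (∀ (h' : F ⇒ E) → e₁ ∘ h' ≈ h ∘ g₁ → e₂ ∘ h' ≈ g₂ → ev ∘ h' ≈ g) ×
          (∀ (k : Y ⇒ Πobj) → Πmap ∘ k ≈ r →
             (∀ (h' : F ⇒ E) → e₁ ∘ h' ≈ k ∘ g₁ → e₂ ∘ h' ≈ g₂ → ev ∘ h' ≈ g) →
             k ≈ h)

  -- Binary products are included as chosen structure (they are pullbacks over 𝟙).
  record LCCCWithFiniteColimits : Set (o ⊔ ℓ ⊔ e) where
    field
      𝟙          : Obj
      𝟙-terminal : IsTerminal 𝟙
      pullback   : ∀ {A B X} (f : A ⇒ X) (g : B ⇒ X) →
                   Σ Obj λ P → Σ (P ⇒ A) λ p → Σ (P ⇒ B) λ q → IsPullback f g p q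
      product    : ∀ A B → Product A B
      depProd    : ∀ {A B X} (f : A ⇒ B) (p : X ⇒ A) → DependentProduct f p
      𝟘          : Obj
      𝟘-initial  : IsInitial 𝟘
      pushout    : ∀ {X A B} (f : X ⇒ A) (g : X ⇒ B) →
                   Σ Obj λ Q → Σ (A ⇒ Q) λ i → Σ (B ⇒ Q) λ j → IsPushout f g i j

    ! : ∀ X → X ⇒ 𝟙
    ! X = Σ.proj₁ (𝟙-terminal X)

    ¡ : ∀ X → 𝟘 ⇒ X
    ¡ X = Σ.proj₁ (𝟘-initial X)

    infixr 7 _×ₒ_
    _×ₒ_ : Obj → Obj → Obj
    A ×ₒ B = Product.A×B (product A B)

    π₁ : ∀ {A B} → A ×ₒ B ⇒ A
    π₁ {A} {B} = Product.π₁ (product A B)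

    π₂ : ∀ {A B} → A ×ₒ B ⇒ B
    π₂ {A} {B} = Product.π₂ (product A B)

    ⟨_,_⟩ : ∀ {Z A B} → Z ⇒ A → Z ⇒ B → Z ⇒ A ×ₒ B
    ⟨_,_⟩ {Z} {A} {B} = Product.⟨_,_⟩ (product A B)

    _⊗_ : ∀ {A B C D} → A ⇒ B → C ⇒ D → A ×ₒ C ⇒ B ×ₒ D
    f ⊗ g = ⟨ f ∘ π₁ , g ∘ π₂ ⟩

    -- j : Q → B × D is (up to the choice of pushout) the pushout product f ×̂ g
    -- of f : A → B and g : C → D, i.e. the map
    -- (A × D) ⊔_{A × C} (B × C) → B × D.
    IsPushoutProduct : ∀ {A B C D Q} → A ⇒ B → C ⇒ D → Q ⇒ B ×ₒ D → Set (o ⊔ ℓ ⊔ e)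
    IsPushoutProduct {A} {B} {C} {D} {Q} f g j =
      Σ (A ×ₒ D ⇒ Q) λ inl → Σ (B ×ₒ C ⇒ Q) λ inr →
        IsPushout (id {A} ⊗ g) (f ⊗ id {C}) inl inr ×
        (j ∘ inl ≈ f ⊗ id {D}) × (j ∘ inr ≈ id {B} ⊗ g)

  LLP : ∀ {A B X Y} → A ⇒ B → X ⇒ Y → Set (ℓ ⊔ e)
  LLP {A} {B} {X} {Y} i p =
    ∀ (u : A ⇒ X) (v : B ⇒ Y) → p ∘ u ≈ v ∘ i →
      Σ (B ⇒ X) λ d → (d ∘ i ≈ u) × (p ∘ d ≈ v)

  record CofibrationsAndInterval (S : LCCCWithFiniteColimits) (c : Level)
         : Set (o ⊔ ℓ ⊔ e ⊔ suc c) where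
    open LCCCWithFiniteColimits S
    field
      Cof : ∀ {A B} → A ⇒ B → Set c
      𝕀   : Obj
      δ₀  : 𝟙 ⇒ 𝕀
      δ₁  : 𝟙 ⇒ 𝕀

    TrivFib : ∀ {X Y} → X ⇒ Y → Set (o ⊔ ℓ ⊔ e ⊔ c)
    TrivFib p = ∀ {A B} (m : A ⇒ B) → Cof m → LLP m p

    Fib : ∀ {X Y} → X ⇒ Y → Set (o ⊔ ℓ ⊔ e ⊔ c)
    Fib p = ∀ {C D} (m : C ⇒ D) → Cof m →
            (∀ {Q} (j : Q ⇒ 𝕀 ×ₒ D) → IsPushoutProduct δ₀ m j → LLP j p) ×
            (∀ {Q} (j : Q ⇒ 𝕀 ×ₒ D) → IsPushoutProduct δ₁ m j → LLP j p)

    TrivCof : ∀ {A B} → A ⇒ B → Set (o ⊔ ℓ ⊔ e ⊔ c)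
    TrivCof i = ∀ {X Y} (p : X ⇒ Y) → Fib p → LLP i p

  record GeneralConditions (S : LCCCWithFiniteColimits) {c : Level}
         (K : CofibrationsAndInterval S c) : Set (o ⊔ ℓ ⊔ e ⊔ c) where
    open LCCCWithFiniteColimits S
    open CofibrationsAndInterval K
    field
      cof-mono : ∀ {A B} (m : A ⇒ B) → Cof m → Mono m
      G1 : ∀ {P A B X} (m : A ⇒ X) (f : B ⇒ X) (q : P ⇒ A) (p : P ⇒ B) →
           IsPullback m f q p → Cof m → Cof p
      -- (G2) closure under binary unions: for cofibrations m : A → X, n : B → X,
      -- the induced map A ∪ B = A ⊔_{A ×_X B} B → X is a cofibration
      G2 : ∀ {A B X P U} (m : A ⇒ X) (n : B ⇒ X) → Cof m → Cof n →
           (p : P ⇒ A) (q : P ⇒ B) → IsPullback m n p q →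
           (i : A ⇒ U) (j : B ⇒ U) → IsPushout p q i j →
           (u : U ⇒ X) → u ∘ i ≈ m → u ∘ j ≈ n → Cof u
      ∧ : 𝕀 ×ₒ 𝕀 ⇒ 𝕀
      ∨ : 𝕀 ×ₒ 𝕀 ⇒ 𝕀
      0∧i : ∧ ∘ ⟨ δ₀ ∘ ! 𝕀 , id ⟩ ≈ δ₀ ∘ ! 𝕀
      i∧0 : ∧ ∘ ⟨ id , δ₀ ∘ ! 𝕀 ⟩ ≈ δ₀ ∘ ! 𝕀
      1∧i : ∧ ∘ ⟨ δ₁ ∘ ! 𝕀 , id ⟩ ≈ id
      i∧1 : ∧ ∘ ⟨ id , δ₁ ∘ ! 𝕀 ⟩ ≈ id
      0∨i : ∨ ∘ ⟨ δ₀ ∘ ! 𝕀 , id ⟩ ≈ id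
      i∨0 : ∨ ∘ ⟨ id , δ₀ ∘ ! 𝕀 ⟩ ≈ id
      1∨i : ∨ ∘ ⟨ δ₁ ∘ ! 𝕀 , id ⟩ ≈ δ₁ ∘ ! 𝕀
      i∨1 : ∨ ∘ ⟨ id , δ₁ ∘ ! 𝕀 ⟩ ≈ δ₁ ∘ ! 𝕀
      G4 : ∀ {P} (p q : P ⇒ 𝟙) → IsPullback δ₀ δ₁ p q → IsInitial P
      G5₀ : Cof δ₀
      G5₁ : Cof δ₁
      G6 : ∀ {A B} (f : A ⇒ B) →
           Σ Obj λ C → Σ (A ⇒ C) λ m → Σ (C ⇒ B) λ p →
             Cof m × TrivFib p × (p ∘ m ≈ f)
      G7 : ∀ X → Cof (¡ X)

-- Factor i = p ∘ m with m a cofibration and p a trivial fibration (G6). Pushout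
-- products of δ₀, δ₁ with cofibrations are cofibrations (G1, G2, G5), so p is a
-- fibration and i lifts against it, giving d with d ∘ i ≈ m and p ∘ d ≈ id. Then
-- i is a retract of m, and this retract square is a pullback, so i is a
-- cofibration by (G1).
module Submission where

open import Level using (Level)
open import Defs
open import Data.Product using (Σ; _×_; _,_)
open import Relation.Binary using (Setoid; IsEquivalence)
import Relation.Binary.Reasoning.Setoid as SetoidReasoning

module CategoryLemmas {o ℓ e : Level} (𝒞 : Category o ℓ e) where
  open Category 𝒞
  open WithCat 𝒞

  module ≈ {A B : Obj} = IsEquivalence (≈-equiv {A} {B})

  hom-setoid : Obj → Obj → Setoid ℓ e
  hom-setoid A B = record { isEquivalence = ≈-equiv {A} {B} }

  module HomReasoning {A B : Obj} = SetoidReasoning (hom-setoid A B)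

  ∘-resp-≈ʳ : ∀ {A B C} {f : B ⇒ C} {g h : A ⇒ B} → g ≈ h → f ∘ g ≈ f ∘ h
  ∘-resp-≈ʳ = ∘-resp-≈ ≈.refl

  ∘-resp-≈ˡ : ∀ {A B C} {f g : B ⇒ C} {h : A ⇒ B} → f ≈ g → f ∘ h ≈ g ∘ h
  ∘-resp-≈ˡ p = ∘-resp-≈ p ≈.refl

  retract-isPullback : ∀ {A B C} {i : A ⇒ B} {m : A ⇒ C} {d : B ⇒ C} {p : C ⇒ B} →
                       d ∘ i ≈ m → p ∘ m ≈ i → p ∘ d ≈ id → IsPullback m d id i
  retract-isPullback {i = i} {m} {d} {p} d∘i≈m p∘m≈i p∘d≈id =
    ≈.trans identityʳ (≈.sym d∘i≈m) ,
    λ a b m∘a≈d∘b → a , identityˡ , i∘a≈b a b m∘a≈d∘b ,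
                    λ v id∘v≈a _ → ≈.trans (≈.sym identityˡ) id∘v≈a
    where
    open HomReasoning
    i∘a≈b : ∀ {Z} (a : Z ⇒ _) (b : Z ⇒ _) → m ∘ a ≈ d ∘ b → i ∘ a ≈ b
    i∘a≈b a b m∘a≈d∘b = begin
      i ∘ a        ≈⟨ ∘-resp-≈ˡ p∘m≈i ⟨
      (p ∘ m) ∘ a  ≈⟨ assoc ⟩
      p ∘ (m ∘ a)  ≈⟨ ∘-resp-≈ʳ m∘a≈d∘b ⟩
      p ∘ (d ∘ b)  ≈⟨ assoc ⟨
      (p ∘ d) ∘ b  ≈⟨ ∘-resp-≈ˡ p∘d≈id ⟩
      id ∘ b       ≈⟨ identityˡ ⟩
      b            ∎

module ProductLemmas {o ℓ e : Level} {𝒞 : Category o ℓ e}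
                     (S : WithCat.LCCCWithFiniteColimits 𝒞) where
  open Category 𝒞
  open WithCat 𝒞
  open LCCCWithFiniteColimits S
  open CategoryLemmas 𝒞

  project₁ : ∀ {Z A B} {f : Z ⇒ A} {g : Z ⇒ B} → π₁ ∘ ⟨ f , g ⟩ ≈ f
  project₁ {A = A} {B} = Product.project₁ (product A B)

  project₂ : ∀ {Z A B} {f : Z ⇒ A} {g : Z ⇒ B} → π₂ ∘ ⟨ f , g ⟩ ≈ g
  project₂ {A = A} {B} = Product.project₂ (product A B)

  π-jointlyMono : ∀ {Z A B} {h k : Z ⇒ A ×ₒ B} →
                  π₁ ∘ h ≈ π₁ ∘ k → π₂ ∘ h ≈ π₂ ∘ k → h ≈ k
  π-jointlyMono {A = A} {B} {h} {k} p q =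
    ≈.trans (Product.unique (product A B) h p q)
            (≈.sym (Product.unique (product A B) k ≈.refl ≈.refl))

  π₁∘⊗ : ∀ {Z A B C D} {f : A ⇒ B} {g : C ⇒ D} {h : Z ⇒ A ×ₒ C} →
         π₁ ∘ ((f ⊗ g) ∘ h) ≈ f ∘ (π₁ ∘ h)
  π₁∘⊗ = ≈.trans (≈.sym assoc) (≈.trans (∘-resp-≈ˡ project₁) assoc)

  π₂∘⊗ : ∀ {Z A B C D} {f : A ⇒ B} {g : C ⇒ D} {h : Z ⇒ A ×ₒ C} →
         π₂ ∘ ((f ⊗ g) ∘ h) ≈ g ∘ (π₂ ∘ h)
  π₂∘⊗ = ≈.trans (≈.sym assoc) (≈.trans (∘-resp-≈ˡ project₂) assoc)

  π₁∘id⊗ : ∀ {Z A C D} {g : C ⇒ D} {h : Z ⇒ A ×ₒ C} →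
           π₁ ∘ ((id ⊗ g) ∘ h) ≈ π₁ ∘ h
  π₁∘id⊗ = ≈.trans π₁∘⊗ identityˡ

  π₂∘⊗id : ∀ {Z A B C} {f : A ⇒ B} {h : Z ⇒ A ×ₒ C} →
           π₂ ∘ ((f ⊗ id) ∘ h) ≈ π₂ ∘ h
  π₂∘⊗id = ≈.trans π₂∘⊗ identityˡ

  π₁-isPullback : ∀ {A B D} (f : A ⇒ B) →
                  IsPullback f (π₁ {B} {D}) (π₁ {A} {D}) (f ⊗ id {D})
  π₁-isPullback f = ≈.sym project₁ , λ a b f∘a≈π₁∘b →
    ⟨ a , π₂ ∘ b ⟩ ,
    project₁ ,
    π-jointlyMono (≈.trans π₁∘⊗ (≈.trans (∘-resp-≈ʳ project₁) f∘a≈π₁∘b))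
                  (≈.trans π₂∘⊗id project₂) ,
    λ v π₁∘v≈a f⊗id∘v≈b →
      π-jointlyMono (≈.trans π₁∘v≈a (≈.sym project₁))
                    (≈.trans (≈.sym π₂∘⊗id)
                             (≈.trans (∘-resp-≈ʳ f⊗id∘v≈b) (≈.sym project₂)))

  π₂-isPullback : ∀ {B C D} (g : C ⇒ D) →
                  IsPullback g (π₂ {B} {D}) (π₂ {B} {C}) (id {B} ⊗ g)
  π₂-isPullback g = ≈.sym project₂ , λ a b g∘a≈π₂∘b →
    ⟨ π₁ ∘ b , a ⟩ ,
    project₂ ,
    π-jointlyMono (≈.trans π₁∘id⊗ project₁)
                  (≈.trans π₂∘⊗ (≈.trans (∘-resp-≈ʳ project₂) g∘a≈π₂∘b)) ,
    λ v π₂∘v≈a id⊗g∘v≈b →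
      π-jointlyMono (≈.trans (≈.sym π₁∘id⊗)
                             (≈.trans (∘-resp-≈ʳ id⊗g∘v≈b) (≈.sym project₁)))
                    (≈.trans π₂∘v≈a (≈.sym project₂))

  ⊗-isPullback : ∀ {A B C D} (f : A ⇒ B) (g : C ⇒ D) →
                 IsPullback (f ⊗ id {D}) (id {B} ⊗ g) (id {A} ⊗ g) (f ⊗ id {C})
  ⊗-isPullback f g = commutes , universal
    where
    open HomReasoning
    commutes : (f ⊗ id) ∘ (id ⊗ g) ≈ (id ⊗ g) ∘ (f ⊗ id)
    commutes = π-jointlyMono
      (begin
        π₁ ∘ ((f ⊗ id) ∘ (id ⊗ g)) ≈⟨ π₁∘⊗ ⟩
        f ∘ (π₁ ∘ (id ⊗ g))        ≈⟨ ∘-resp-≈ʳ (≈.trans project₁ identityˡ) ⟩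
        f ∘ π₁                     ≈⟨ project₁ ⟨
        π₁ ∘ (f ⊗ id)              ≈⟨ π₁∘id⊗ ⟨
        π₁ ∘ ((id ⊗ g) ∘ (f ⊗ id)) ∎)
      (begin
        π₂ ∘ ((f ⊗ id) ∘ (id ⊗ g)) ≈⟨ π₂∘⊗id ⟩
        π₂ ∘ (id ⊗ g)              ≈⟨ project₂ ⟩
        g ∘ π₂                     ≈⟨ ∘-resp-≈ʳ (≈.trans project₂ identityˡ) ⟨
        g ∘ (π₂ ∘ (f ⊗ id))        ≈⟨ π₂∘⊗ ⟨
        π₂ ∘ ((id ⊗ g) ∘ (f ⊗ id)) ∎)
    universal : ∀ {Z} (a : Z ⇒ _) (b : Z ⇒ _) → (f ⊗ id) ∘ a ≈ (id ⊗ g) ∘ b →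
      Σ (Z ⇒ _) λ u → ((id ⊗ g) ∘ u ≈ a) × ((f ⊗ id) ∘ u ≈ b) ×
        (∀ (v : Z ⇒ _) → (id ⊗ g) ∘ v ≈ a → (f ⊗ id) ∘ v ≈ b → v ≈ u)
    universal a b eq = ⟨ π₁ ∘ a , π₂ ∘ b ⟩ ,
      π-jointlyMono (≈.trans π₁∘id⊗ project₁)
        (begin
          π₂ ∘ ((id ⊗ g) ∘ ⟨ π₁ ∘ a , π₂ ∘ b ⟩) ≈⟨ π₂∘⊗ ⟩
          g ∘ (π₂ ∘ ⟨ π₁ ∘ a , π₂ ∘ b ⟩)        ≈⟨ ∘-resp-≈ʳ project₂ ⟩
          g ∘ (π₂ ∘ b)                          ≈⟨ π₂∘⊗ ⟨
          π₂ ∘ ((id ⊗ g) ∘ b)                   ≈⟨ ∘-resp-≈ʳ eq ⟨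
          π₂ ∘ ((f ⊗ id) ∘ a)                   ≈⟨ π₂∘⊗id ⟩
          π₂ ∘ a                                ∎) ,
      π-jointlyMono
        (begin
          π₁ ∘ ((f ⊗ id) ∘ ⟨ π₁ ∘ a , π₂ ∘ b ⟩) ≈⟨ π₁∘⊗ ⟩
          f ∘ (π₁ ∘ ⟨ π₁ ∘ a , π₂ ∘ b ⟩)        ≈⟨ ∘-resp-≈ʳ project₁ ⟩
          f ∘ (π₁ ∘ a)                          ≈⟨ π₁∘⊗ ⟨
          π₁ ∘ ((f ⊗ id) ∘ a)                   ≈⟨ ∘-resp-≈ʳ eq ⟩
          π₁ ∘ ((id ⊗ g) ∘ b)                   ≈⟨ π₁∘id⊗ ⟩
          π₁ ∘ b                                ∎)
        (≈.trans π₂∘⊗id project₂) ,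
      λ v id⊗g∘v≈a f⊗id∘v≈b → π-jointlyMono
        (≈.trans (≈.sym π₁∘id⊗) (≈.trans (∘-resp-≈ʳ id⊗g∘v≈a) (≈.sym project₁)))
        (≈.trans (≈.sym π₂∘⊗id) (≈.trans (∘-resp-≈ʳ f⊗id∘v≈b) (≈.sym project₂)))

module CofibrationLemmas {o ℓ e c : Level} {𝒞 : Category o ℓ e}
                         {S : WithCat.LCCCWithFiniteColimits 𝒞}
                         {K : WithCat.CofibrationsAndInterval 𝒞 S c}
                         (G : WithCat.GeneralConditions 𝒞 S K) where
  open Category 𝒞
  open WithCat.LCCCWithFiniteColimits S
  open WithCat.CofibrationsAndInterval K
  open WithCat.GeneralConditions G
  open ProductLemmas S

  pushoutProduct-cof : ∀ {A B C D Q} {f : A ⇒ B} {g : C ⇒ D} {j : Q ⇒ B ×ₒ D} →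
                       Cof f → Cof g → IsPushoutProduct f g j → Cof j
  pushoutProduct-cof {f = f} {g} {j} f-cof g-cof (inl , inr , isPushout , j∘inl , j∘inr) =
    G2 (f ⊗ id) (id ⊗ g)
       (G1 f π₁ π₁ (f ⊗ id) (π₁-isPullback f) f-cof)
       (G1 g π₂ π₂ (id ⊗ g) (π₂-isPullback g) g-cof)
       (id ⊗ g) (f ⊗ id) (⊗-isPullback f g) inl inr isPushout j j∘inl j∘inr

  trivFib⇒fib : ∀ {X Y} {p : X ⇒ Y} → TrivFib p → Fib p
  trivFib⇒fib p-trivFib m m-cof =
    (λ j isPP → p-trivFib j (pushoutProduct-cof G5₀ m-cof isPP)) ,
    (λ j isPP → p-trivFib j (pushoutProduct-cof G5₁ m-cof isPP))

mainTheorem5 : ∀ {o ℓ e c : Level} (𝒞 : Category o ℓ e)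
                 (S : WithCat.LCCCWithFiniteColimits 𝒞)
                 (K : WithCat.CofibrationsAndInterval 𝒞 S c) →
                 WithCat.GeneralConditions 𝒞 S K →
                 ∀ {A B : Category.Obj 𝒞} (i : Category._⇒_ 𝒞 A B) →
                 WithCat.CofibrationsAndInterval.TrivCof K i →
                 WithCat.CofibrationsAndInterval.Cof K i
mainTheorem5 𝒞 S K G i i-trivCof =
  let (_ , m , p , m-cof , p-trivFib , p∘m≈i) = G6 i
      (d , d∘i≈m , p∘d≈id) = i-trivCof p (trivFib⇒fib p-trivFib) m id
                                          (≈.trans p∘m≈i (≈.sym identityˡ))
  in G1 m d id i (retract-isPullback d∘i≈m p∘m≈i p∘d≈id) m-cof
  where
  open Category 𝒞
  open WithCat.GeneralConditions G
  open CategoryLemmas 𝒞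
  open CofibrationLemmas G
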